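{- Let $d\in\mathbb{N}$, $d\ge2$, and let $p_1\ge p_2\ge\dots\ge p_n$ be a non-increasing list of numbers of the form $p_i=d^{ -a_i}$ with $a_i\in\mathbb{N}$, and let $a\in\mathbb{N}$ with $a\le a_1$. If $\sum_{i=1}^np_i\ge d^{ -a}$, then for some $m$ we have $\sum_{i=1}^mp_i=d^{ -a}$. If furthermore $\sum_{i=1}^np_i=l\cdot d^{ -a}$ for some $l\in\mathbb{N}$, then $[n]$ can be divided into $l$ intervals $(I_j)_{j\in[l]}$ such that $\sum_{i\in I_j}p_i=d^{ -a}$ for every $j$.
   Context: $\mathbb{N}=\{0,1,2,\dots\}$, $[n]=\{1,\dots,n\}$. -}

module Defs where

open import Data.Nat using (ℕ; _^_; NonZero)
open import Data.Nat.Properties using (m^n≢0)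
open import Data.Integer using (+_)
open import Data.Rational using (ℚ; _/_; _+_; 0ℚ)
open import Data.List using (List; foldr)

pw : (d : ℕ) → .{{NonZero d}} → ℕ → ℚ
pw d k = (+ 1) / (d ^ k)
  where instance _ = m^n≢0 d k

sumℚ : List ℚ → ℚ
sumℚ = foldr _+_ 0ℚ

-- Scaling by d^K, where K is the largest exponent, turns the p_i into natural
-- numbers w_i = d^(K - a_i) and d^(-a) into T = d^(K - a).  Since the p_i are
-- non-increasing, each w_i divides its predecessor, and a ≤ a_1 makes every w_i
-- divide T.  For such a divisibility chain the partial sums cannot jump over T,
-- so some prefix sums to exactly T; cutting it off and repeating yields the
-- l intervals.
module Submission where

open import Defs
open import Data.Nat using (ℕ; zero; suc; _+_; _*_; _∸_; _^_; _≤_; _<_; z≤n; s≤s; NonZero)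
open import Data.Nat.Properties
open import Data.Nat.Divisibility using (_∣_; ∣-refl; ∣-trans; ∣⇒≤; m∣m*n; ∣m+n∣m⇒∣n)
open import Data.Nat.ListAction using (sum)
open import Data.Nat.ListAction.Properties using (sum-++)
open import Data.Nat.Tactic.RingSolver using (solve)
open import Data.Integer as ℤ using (+_)
open import Data.Integer.Tactic.RingSolver using (solve-∀)
import Data.Integer.Properties as ℤ
open import Data.Rational using (ℚ; _≥_; _/_; toℚᵘ) renaming (_*_ to _*ℚ_)
open import Data.Rational as ℚ using (Positive)
import Data.Rational.Properties as ℚ
open import Data.Rational.Unnormalised as ℚᵘ using (mkℚᵘ; *≡*; *≤*)
import Data.Rational.Unnormalised.Properties as ℚᵘ
import Data.List as List
open import Data.List using (List; []; _∷_; map; take; drop; length; concat; _++_)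
open import Data.List.Properties using (length-map; take-map; concat-map; take++drop≡id; map-cong-local; map-∘)
open import Data.List.Extrema ≤-totalOrder using (max; xs≤max)
open import Data.List.Relation.Unary.All as All using (All; []; _∷_)
open import Data.List.Relation.Unary.All.Properties using (map⁺; drop⁺)
open import Data.List.Relation.Unary.Linked as Linked using (Linked)
import Data.List.Relation.Unary.Linked.Properties as Linked
open import Data.Product using (∃; _×_; _,_)
open import Data.Sum using (inj₁; inj₂)
open import Function using (flip)
open import Relation.Binary.PropositionalEquality

ι : ℕ → ℚ
ι n = + n / 1

toℚᵘ-ι : ∀ n → toℚᵘ (ι n) ℚᵘ.≃ mkℚᵘ (+ n) 0
toℚᵘ-ι n = ℚ.toℚᵘ-fromℚᵘ (mkℚᵘ (+ n) 0)

ι-+ : ∀ m n → ι (m + n) ≡ ι m ℚ.+ ι n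
ι-+ m n = ℚ.toℚᵘ-injective (begin
  toℚᵘ (ι (m + n))                  ≈⟨ toℚᵘ-ι (m + n) ⟩
  mkℚᵘ (+ m ℤ.+ + n) 0             ≈⟨ *≡* (integral (+ m) (+ n)) ⟩
  mkℚᵘ (+ m) 0 ℚᵘ.+ mkℚᵘ (+ n) 0   ≈⟨ ℚᵘ.+-cong (toℚᵘ-ι m) (toℚᵘ-ι n) ⟨
  toℚᵘ (ι m) ℚᵘ.+ toℚᵘ (ι n)       ≈⟨ ℚ.toℚᵘ-homo-+ (ι m) (ι n) ⟨
  toℚᵘ (ι m ℚ.+ ι n)                ∎)
  where
  open ℚᵘ.≃-Reasoning
  integral : ∀ i j → (i ℤ.+ j) ℤ.* + 1 ≡ (i ℤ.* + 1 ℤ.+ j ℤ.* + 1) ℤ.* + 1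
  integral = solve-∀

ι-* : ∀ m n → ι (m * n) ≡ ι m *ℚ ι n
ι-* m n = ℚ.toℚᵘ-injective (begin
  toℚᵘ (ι (m * n))                  ≈⟨ toℚᵘ-ι (m * n) ⟩
  mkℚᵘ (+ (m * n)) 0               ≡⟨ cong (λ i → mkℚᵘ i 0) (ℤ.pos-* m n) ⟩
  mkℚᵘ (+ m) 0 ℚᵘ.* mkℚᵘ (+ n) 0   ≈⟨ ℚᵘ.*-cong (toℚᵘ-ι m) (toℚᵘ-ι n) ⟨
  toℚᵘ (ι m) ℚᵘ.* toℚᵘ (ι n)       ≈⟨ ℚ.toℚᵘ-homo-* (ι m) (ι n) ⟨
  toℚᵘ (ι m *ℚ ι n)                 ∎)
  where open ℚᵘ.≃-Reasoning

ι-cancel-≤ : ∀ {m n} → ι m ℚ.≤ ι n → m ≤ n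
ι-cancel-≤ {m} {n} ιm≤ιn
  with ℚᵘ.≤-respˡ-≃ (toℚᵘ-ι m) (ℚᵘ.≤-respʳ-≃ (toℚᵘ-ι n) (ℚ.toℚᵘ-mono-≤ ιm≤ιn))
... | *≤* m*1≤n*1 = ℤ.drop‿+≤+ (subst₂ ℤ._≤_ (ℤ.*-identityʳ (+ m)) (ℤ.*-identityʳ (+ n)) m*1≤n*1)

-- ℚᵘ stores denominators minus one, so the cross-multiplication is an identity
-- under + suc.
1/n≡k*1/m : ∀ k n m .{{_ : NonZero k}} .{{_ : NonZero n}} .{{_ : NonZero m}} →
            m ≡ k * n → + 1 / n ≡ ι k *ℚ (+ 1 / m)
1/n≡k*1/m (suc k) (suc n) .(suc k * suc n) refl = ℚ.toℚᵘ-injective (begin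
  toℚᵘ (+ 1 / suc n)                                  ≈⟨ ℚ.toℚᵘ-fromℚᵘ (mkℚᵘ (+ 1) n) ⟩
  mkℚᵘ (+ 1) n                                         ≈⟨ *≡* (cong (λ x → + suc x) (solve (n List.∷ k List.∷ List.[]))) ⟩
  mkℚᵘ (+ suc k) 0 ℚᵘ.* mkℚᵘ (+ 1) (n + k * suc n)    ≈⟨ ℚᵘ.*-cong (toℚᵘ-ι (suc k)) (ℚ.toℚᵘ-fromℚᵘ (mkℚᵘ (+ 1) (n + k * suc n))) ⟨
  toℚᵘ (ι (suc k)) ℚᵘ.* toℚᵘ (+ 1 / (suc k * suc n))  ≈⟨ ℚ.toℚᵘ-homo-* (ι (suc k)) (+ 1 / (suc k * suc n)) ⟨
  toℚᵘ (ι (suc k) *ℚ (+ 1 / (suc k * suc n)))         ∎)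
  where open ℚᵘ.≃-Reasoning

module _ (c : ℚ) where

  sumℚ-map-ι* : ∀ ws → sumℚ (map (λ w → ι w *ℚ c) ws) ≡ ι (sum ws) *ℚ c
  sumℚ-map-ι* [] = sym (ℚ.*-zeroˡ c)
  sumℚ-map-ι* (w ∷ ws) = begin
    ι w *ℚ c ℚ.+ sumℚ (map (λ w → ι w *ℚ c) ws)  ≡⟨ cong (ι w *ℚ c ℚ.+_) (sumℚ-map-ι* ws) ⟩
    ι w *ℚ c ℚ.+ ι (sum ws) *ℚ c                 ≡⟨ ℚ.*-distribʳ-+ c (ι w) (ι (sum ws)) ⟨
    (ι w ℚ.+ ι (sum ws)) *ℚ c                    ≡⟨ cong (_*ℚ c) (ι-+ w (sum ws)) ⟨
    ι (w + sum ws) *ℚ c                          ∎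
    where open ≡-Reasoning

  module _ .{{_ : Positive c}} where

    ι*-cancelʳ-≤ : ∀ {m n} → ι m *ℚ c ℚ.≤ ι n *ℚ c → m ≤ n
    ι*-cancelʳ-≤ le = ι-cancel-≤ (ℚ.*-cancelʳ-≤-pos c le)

    ι*-injective : ∀ {m n} → ι m *ℚ c ≡ ι n *ℚ c → m ≡ n
    ι*-injective eq = ≤-antisym (ι*-cancelʳ-≤ (ℚ.≤-reflexive eq)) (ι*-cancelʳ-≤ (ℚ.≤-reflexive (sym eq)))

Linked-drop⁺ : ∀ {a r} {A : Set a} {R : A → A → Set r} m {xs} → Linked R xs → Linked R (drop m xs)
Linked-drop⁺ zero           chain = chain
Linked-drop⁺ (suc m) {[]}    chain = chain
Linked-drop⁺ (suc m) {_ ∷ _} chain = Linked-drop⁺ m (Linked.tail chain)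

∣m∣n⇒∣m∸n : ∀ {d m n} → n ≤ m → d ∣ m → d ∣ n → d ∣ m ∸ n
∣m∣n⇒∣m∸n {d} n≤m d∣m d∣n = ∣m+n∣m⇒∣n (subst (d ∣_) (sym (m+[n∸m]≡n n≤m)) d∣m) d∣n

sum-take+sum-drop : ∀ m ws → sum (take m ws) + sum (drop m ws) ≡ sum ws
sum-take+sum-drop m ws = trans (sym (sum-++ (take m ws) (drop m ws))) (cong sum (take++drop≡id m ws))

-- Each term divides its predecessor and T, so while the running sum is below T
-- the next term still fits: T minus the running sum stays a multiple of it.
prefix-sum≡ : ∀ T {ws} → Linked (flip _∣_) ws → All (_∣ T) ws → T ≤ sum ws →
              ∃ λ m → m ≤ length ws × sum (take m ws) ≡ T
prefix-sum≡ zero    _ _ _ = 0 , z≤n , refl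
prefix-sum≡ (suc t) {w ∷ ws} chain (w∣T ∷ ws∣T) T≤sum =
  let m , m≤ , sum≡ = prefix-sum≡ (T ∸ w) (Linked.tail chain) ws∣T∸w (m≤n+o⇒m∸n≤o T w T≤sum)
  in suc m , s≤s m≤ , (begin
    w + sum (take m ws)  ≡⟨ cong (_+_ w) sum≡ ⟩
    w + (T ∸ w)          ≡⟨ m+[n∸m]≡n w≤T ⟩
    T                    ∎)
  where
  open ≡-Reasoning
  T = suc t
  w≤T : w ≤ T
  w≤T = ∣⇒≤ w∣T
  ws∣w : All (_∣ w) ws
  ws∣w = All.tail (Linked.Linked⇒All (flip ∣-trans) ∣-refl chain)
  ws∣T∸w : All (_∣ T ∸ w) ws
  ws∣T∸w = All.zipWith (λ (x∣T , x∣w) → ∣m∣n⇒∣m∸n w≤T x∣T x∣w) (ws∣T , ws∣w)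

sum≡0⇒[] : ∀ {ws} → All (0 <_) ws → sum ws ≡ 0 → ws ≡ []
sum≡0⇒[] []            _  = refl
sum≡0⇒[] (s≤s _ ∷ _) ()

intervals-sum≡ : ∀ T l {ws} → All (0 <_) ws → Linked (flip _∣_) ws → All (_∣ T) ws → sum ws ≡ l * T →
                 ∃ λ (blocks : List (List ℕ)) →
                   length blocks ≡ l × concat blocks ≡ ws × All (λ b → sum b ≡ T) blocks
intervals-sum≡ T zero    ws>0 _ _ sum≡0 = [] , refl , sym (sum≡0⇒[] ws>0 sum≡0) , []
intervals-sum≡ T (suc l) {ws} ws>0 chain ws∣T sum≡ =
  let m , _ , prefix≡T = prefix-sum≡ T chain ws∣T (subst (T ≤_) (sym sum≡) (m≤m+n T (l * T)))
      rest≡ = +-cancelˡ-≡ T _ _ (begin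
        T + sum (drop m ws)                ≡⟨ cong (_+ sum (drop m ws)) prefix≡T ⟨
        sum (take m ws) + sum (drop m ws)  ≡⟨ sum-take+sum-drop m ws ⟩
        sum ws                             ≡⟨ sum≡ ⟩
        T + l * T                          ∎)
      blocks , length≡ , concat≡ , sums≡ =
        intervals-sum≡ T l (drop⁺ m ws>0) (Linked-drop⁺ m chain) (drop⁺ m ws∣T) rest≡
  in take m ws ∷ blocks , cong suc length≡ ,
     trans (cong (take m ws ++_) concat≡) (take++drop≡id m ws) , prefix≡T ∷ sums≡
  where open ≡-Reasoning

HasPrefixSum : List ℚ → ℚ → Set
HasPrefixSum ps t = ∃ λ m → m ≤ length ps × sumℚ (take m ps) ≡ t

SplitsInto : ℕ → List ℚ → ℚ → Set
SplitsInto l ps t = ∃ λ (blocks : List (List ℚ)) →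
  length blocks ≡ l × concat blocks ≡ ps × All (λ b → sumℚ b ≡ t) blocks

module _ (c : ℚ) .{{_ : Positive c}} (T : ℕ) {ws : List ℕ}
         (chain : Linked (flip _∣_) ws) (ws∣T : All (_∣ T) ws) where

  private
    scale : ℕ → ℚ
    scale w = ι w *ℚ c

  hasPrefixSum-scaled : sumℚ (map scale ws) ≥ scale T → HasPrefixSum (map scale ws) (scale T)
  hasPrefixSum-scaled sum≥ =
    let m , m≤ , sum≡ = prefix-sum≡ T chain ws∣T (ι*-cancelʳ-≤ c (subst (scale T ℚ.≤_) (sumℚ-map-ι* c ws) sum≥))
    in m , subst (m ≤_) (sym (length-map scale ws)) m≤ , (begin
      sumℚ (take m (map scale ws))  ≡⟨ cong sumℚ (take-map m ws) ⟩
      sumℚ (map scale (take m ws))  ≡⟨ sumℚ-map-ι* c (take m ws) ⟩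
      scale (sum (take m ws))       ≡⟨ cong scale sum≡ ⟩
      scale T                       ∎)
    where open ≡-Reasoning

  splitsInto-scaled : All (0 <_) ws → ∀ l → sumℚ (map scale ws) ≡ ι l *ℚ scale T →
                      SplitsInto l (map scale ws) (scale T)
  splitsInto-scaled ws>0 l sum≡ =
    let blocks , length≡ , concat≡ , sums≡ = intervals-sum≡ T l ws>0 chain ws∣T (ι*-injective c sum≡′)
    in map (map scale) blocks ,
       trans (length-map (map scale) blocks) length≡ ,
       trans (concat-map blocks) (cong (map scale) concat≡) ,
       map⁺ (All.map (λ {b} sum-b≡T → trans (sumℚ-map-ι* c b) (cong scale sum-b≡T)) sums≡)
    where
    open ≡-Reasoning
    sum≡′ : scale (sum ws) ≡ scale (l * T)
    sum≡′ = begin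
      scale (sum ws)         ≡⟨ sumℚ-map-ι* c ws ⟨
      sumℚ (map scale ws)    ≡⟨ sum≡ ⟩
      ι l *ℚ (ι T *ℚ c)      ≡⟨ ℚ.*-assoc (ι l) (ι T) c ⟨
      (ι l *ℚ ι T) *ℚ c      ≡⟨ cong (_*ℚ c) (ι-* l T) ⟨
      scale (l * T)          ∎

n≤o⇒m^n∣m^o : ∀ m {n o} → n ≤ o → m ^ n ∣ m ^ o
n≤o⇒m^n∣m^o m {n} {o} n≤o = subst (m ^ n ∣_) mⁿ*mᵒ⁻ⁿ≡mᵒ (m∣m*n (m ^ (o ∸ n)))
  where
  mⁿ*mᵒ⁻ⁿ≡mᵒ : m ^ n * m ^ (o ∸ n) ≡ m ^ o
  mⁿ*mᵒ⁻ⁿ≡mᵒ = trans (sym (^-distribˡ-+-* m n (o ∸ n))) (cong (m ^_) (m+[n∸m]≡n n≤o))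

^-cancelʳ-≤ : ∀ m → 1 < m → ∀ {n o} → m ^ n ≤ m ^ o → n ≤ o
^-cancelʳ-≤ m 1<m mⁿ≤mᵒ = ≮⇒≥ (λ o<n → <⇒≱ (^-monoʳ-< m 1<m o<n) mⁿ≤mᵒ)

module _ (d : ℕ) .{{_ : NonZero d}} where

  pw-positive : ∀ k → Positive (pw d k)
  pw-positive k = ℚ.normalize-pos 1 (d ^ k) {{m^n≢0 d k}}

  pw-+ : ∀ j k → pw d k ≡ ι (d ^ j) *ℚ pw d (j + k)
  pw-+ j k = 1/n≡k*1/m (d ^ j) (d ^ k) (d ^ (j + k)) {{m^n≢0 d j}} {{m^n≢0 d k}} {{m^n≢0 d (j + k)}}
                         (^-distribˡ-+-* d j k)

  pw-scaled : ∀ {K k} → k ≤ K → pw d k ≡ ι (d ^ (K ∸ k)) *ℚ pw d K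
  pw-scaled {K} {k} k≤K = trans (pw-+ (K ∸ k) k) (cong (λ n → ι (d ^ (K ∸ k)) *ℚ pw d n) (m∸n+n≡m k≤K))

  pw-cancel-≤ : 1 < d → ∀ {j k} → pw d j ℚ.≤ pw d k → k ≤ j
  pw-cancel-≤ 1<d {j} {k} pʲ≤pᵏ with ≤-total k j
  ... | inj₁ k≤j = k≤j
  ... | inj₂ j≤k = m∸n≡0⇒m≤n (n≤0⇒n≡0 (^-cancelʳ-≤ d 1<d dᵏ⁻ʲ≤1))
    where
    dᵏ⁻ʲ≤1 : d ^ (k ∸ j) ≤ 1
    dᵏ⁻ʲ≤1 = ι*-cancelʳ-≤ (pw d k) {{pw-positive k}}
               (subst₂ ℚ._≤_ (pw-scaled j≤k) (sym (ℚ.*-identityˡ (pw d k))) pʲ≤pᵏ)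

lemma6p4 : (d : ℕ) .{{_ : NonZero d}} → 2 ≤ d →
    (a₁ : ℕ) (as : List ℕ) →
    let ps = map (pw d) (a₁ ∷ as) in
    Linked _≥_ ps →
    (a : ℕ) → a ≤ a₁ →
    sumℚ ps ≥ pw d a →
    (∃ λ m → m ≤ length ps × sumℚ (take m ps) ≡ pw d a)
    × ((l : ℕ) → sumℚ ps ≡ (+ l / 1) *ℚ pw d a →
        ∃ λ (blocks : List (List ℚ)) →
          length blocks ≡ l × concat blocks ≡ ps × All (λ b → sumℚ b ≡ pw d a) blocks)
lemma6p4 d 2≤d a₁ as descending a a≤a₁ =
  subst₂ (λ ps t → sumℚ ps ≥ t → HasPrefixSum ps t × (∀ l → sumℚ ps ≡ ι l *ℚ t → SplitsInto l ps t))
         (sym ps≡) (sym (pw-scaled d a≤K))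
         (λ sum≥ → hasPrefixSum-scaled c T chain ws∣T sum≥ , splitsInto-scaled c T chain ws∣T ws>0)
  where
  es = a₁ ∷ as
  K = max 0 es
  c = pw d K
  instance _ = pw-positive d K
  weight : ℕ → ℕ
  weight k = d ^ (K ∸ k)
  ws = map weight es
  T = weight a
  es≤K : All (_≤ K) es
  es≤K = xs≤max 0 es
  a≤K : a ≤ K
  a≤K = ≤-trans a≤a₁ (All.head es≤K)
  ps≡ : map (pw d) es ≡ map (λ w → ι w *ℚ c) ws
  ps≡ = trans (map-cong-local (All.map (pw-scaled d) es≤K)) (map-∘ es)
  ascending : Linked _≤_ es
  ascending = Linked.map (pw-cancel-≤ d 2≤d) (Linked.map⁻ descending)
  weight-∣ : ∀ {j k} → j ≤ k → weight k ∣ weight j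
  weight-∣ j≤k = n≤o⇒m^n∣m^o d (∸-monoʳ-≤ K j≤k)
  chain : Linked (flip _∣_) ws
  chain = Linked.map⁺ (Linked.map weight-∣ ascending)
  ws∣T : All (_∣ T) ws
  ws∣T = map⁺ (All.map weight-∣ (Linked.Linked⇒All ≤-trans a≤a₁ ascending))
  ws>0 : All (0 <_) ws
  ws>0 = map⁺ (All.universal (λ k → m^n>0 d (K ∸ k)) es)
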